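{- In the pure bang calculus $(\Lambda_!,\to_{!\beta})$, $\to_{\ell\ell,!\beta}$ is a normalizing strategy for $\to_{!\beta}$: it has the same normal forms as $\to_{!\beta}$, and whenever $T\to_{!\beta}^* U$ with $U$ $!\beta$-normal, every maximal $\to_{\ell\ell,!\beta}$-sequence from $T$ ends in a $!\beta$-normal form.
   Context: Pure bang terms: $T ::= x\mid\lambda x.T\mid TS\mid !T$ (set $\Lambda_!$), contexts $C ::= [\cdot]\mid\lambda x.C\mid TC\mid CT\mid !C$. $\to_{!\beta}$ is the contextual closure of $(\lambda x.T)\,!S\mapsto_{!\beta}T[S/x]$. Level: $\mathrm{lev}([\cdot])=0$, $\mathrm{lev}(!C)=\mathrm{lev}(C)+1$, unchanged under $\lambda$ and application. $\mathrm{ll}(T)=\inf\{\mathrm{lev}(C)\mid T=C[R], R\text{ a }!\beta\text{ -redex}\}$. A step $C[R]\to_{!\beta}C[R']$ is least-level ($\to_{\ell\ell,!\beta}$) if $\mathrm{lev}(C)=\mathrm{ll}(C[R])$. -}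

module Defs where

open import Data.Nat using (ℕ; zero; suc; _≤_; _<_)
open import Data.Product using (Σ; _×_; ∃; _,_)
open import Relation.Binary.PropositionalEquality using (_≡_)
open import Relation.Nullary using (¬_)
open import Relation.Binary.Construct.Closure.ReflexiveTransitive using (Star)

-- Pure bang terms, with variables as de Bruijn indices
-- (terms up to α-equivalence).
data Term : Set where
  var  : ℕ → Term
  lam  : Term → Term
  app  : Term → Term → Term
  bang : Term → Term

ext : (ℕ → ℕ) → ℕ → ℕ
ext ρ zero    = zero
ext ρ (suc n) = suc (ρ n)

rename : (ℕ → ℕ) → Term → Term
rename ρ (var n)   = var (ρ n)
rename ρ (lam t)   = lam (rename (ext ρ) t)
rename ρ (app t u) = app (rename ρ t) (rename ρ u)
rename ρ (bang t)  = bang (rename ρ t)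

exts : (ℕ → Term) → ℕ → Term
exts σ zero    = var zero
exts σ (suc n) = rename suc (σ n)

subst : (ℕ → Term) → Term → Term
subst σ (var n)   = σ n
subst σ (lam t)   = lam (subst (exts σ) t)
subst σ (app t u) = app (subst σ t) (subst σ u)
subst σ (bang t)  = bang (subst σ t)

-- T[S/x], where x is the variable bound by the enclosing λ (index 0)
single : Term → ℕ → Term
single s zero    = s
single s (suc n) = var n

_[_/0] : Term → Term → Term
t [ s /0] = subst (single s) t

data Ctx : Set where
  hole  : Ctx
  lamC  : Ctx → Ctx
  appR  : Term → Ctx → Ctx
  appL  : Ctx → Term → Ctx
  bangC : Ctx → Ctx

plug : Ctx → Term → Term
plug hole      r = r
plug (lamC c)  r = lam (plug c r)
plug (appR t c) r = app t (plug c r)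
plug (appL c t) r = app (plug c r) t
plug (bangC c) r = bang (plug c r)

lev : Ctx → ℕ
lev hole       = 0
lev (lamC c)   = lev c
lev (appR t c) = lev c
lev (appL c t) = lev c
lev (bangC c)  = suc (lev c)

IsRedex : Term → Set
IsRedex r = Σ Term λ t → Σ Term λ s → r ≡ app (lam t) (bang s)

data _↦!β_ : Term → Term → Set where
  !β : ∀ t s → app (lam t) (bang s) ↦!β (t [ s /0])

data StepAt (C : Ctx) : Term → Term → Set where
  step : ∀ {r r'} → r ↦!β r' → StepAt C (plug C r) (plug C r')

_→!β_ : Term → Term → Set
T →!β U = Σ Ctx λ C → StepAt C T U

_→!β*_ : Term → Term → Set
_→!β*_ = Star _→!β_

-- lev(C) = ll(T): lev(C) is the least level of a redex occurrence in T.
-- (When a step at C exists the set of redex levels is non-empty, so its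
--  infimum equals lev C iff lev C is a lower bound of that set.)
IsLeastLevel : Ctx → Term → Set
IsLeastLevel C T = ∀ (C' : Ctx) (R : Term) → IsRedex R → T ≡ plug C' R → lev C ≤ lev C'

_→ll_ : Term → Term → Set
T →ll U = Σ Ctx λ C → StepAt C T U × IsLeastLevel C T

NormalFor : (Term → Term → Set) → Term → Set
NormalFor _⇒_ T = ¬ (∃ λ U → T ⇒ U)

!β-normal : Term → Set
!β-normal = NormalFor _→!β_

ll-normal : Term → Set
ll-normal = NormalFor _→ll_

InfiniteLLSeq : Term → (ℕ → Term) → Set
InfiniteLLSeq T f = (f 0 ≡ T) × (∀ i → f i →ll f (suc i))

MaximalFiniteLLSeq : Term → ℕ → (ℕ → Term) → Set
MaximalFiniteLLSeq T n f = (f 0 ≡ T) × (∀ i → i < n → f i →ll f (suc i)) × ll-normal (f n)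

-- Any reduction T ⟶* U factorizes into surface steps (redexes at level 0)
-- followed by internal steps (inside !-boxes).  Internal steps neither create nor
-- erase surface redexes, so when U is normal the surface part ends in a
-- surface-normal T' of the same shape as U, whose !-boxes reduce to those of U.
-- Surface steps have the diamond property, hence all surface paths from T to T'
-- have the same length, and every least-level step from T, being a surface step,
-- shortens them.  With induction on U for the boxes, T is strongly normalizing
-- for least-level reduction.  A term with a redex has one of least level, so
-- least-level normal forms are normal.
module Submission where

open import Defs
open import Level using (_⊔_)
open import Data.Nat using (ℕ; zero; suc; _≤_; z≤n; s≤s; s≤s⁻¹)
open import Data.Nat.Properties using (≤-trans; ≤-total; n≤0⇒n≡0)
open import Data.Product using (_×_; ∃; _,_; map; map₂)
open import Data.Sum using (_⊎_; inj₁; inj₂)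
open import Data.Empty using (⊥-elim)
open import Function.Base using (flip; id)
open import Function.Bundles using (_⇔_; mk⇔)
open import Induction.WellFounded using (Acc; acc)
open import Relation.Binary.Core using (Rel)
open import Relation.Binary.Construct.Closure.ReflexiveTransitive
  using (Star; ε; _◅_; _◅◅_; gmap; foldl)
open import Relation.Binary.PropositionalEquality
  using (_≡_; refl; sym; trans; cong; cong₂; module ≡-Reasoning)
  renaming (subst to transport)
open import Relation.Nullary using (¬_; Dec; yes; no)

module _ {a ℓ} {A : Set a} {_≺_ : Rel A ℓ} where

  Acc⇒¬descending : ∀ (f : ℕ → A) i → Acc _≺_ (f i) → ¬ (∀ j → f (suc j) ≺ f j)
  Acc⇒¬descending f i (acc rs) desc = Acc⇒¬descending f (suc i) (rs (desc i)) desc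

module RandomDescent {a ℓ} {A : Set a} (_⟶_ : Rel A ℓ)
  (diamond : ∀ {t u v} → t ⟶ u → t ⟶ v → u ≡ v ⊎ ∃ λ w → u ⟶ w × v ⟶ w) where

  infixr 5 _∷_

  data _⟶^[_]_ : A → ℕ → A → Set (a ⊔ ℓ) where
    []  : ∀ {t} → t ⟶^[ 0 ] t
    _∷_ : ∀ {t u v n} → t ⟶ u → u ⟶^[ n ] v → t ⟶^[ suc n ] v

  Star⇒⟶^ : ∀ {t u} → Star _⟶_ t u → ∃ λ n → t ⟶^[ n ] u
  Star⇒⟶^ ε        = 0 , []
  Star⇒⟶^ (r ◅ rs) = map suc (r ∷_) (Star⇒⟶^ rs)

  step-shortens-path-to-normal : ∀ {n t u v} → t ⟶^[ suc n ] v → ¬ ∃ (v ⟶_) →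
                                 t ⟶ u → u ⟶^[ n ] v
  step-shortens-path-to-normal (t⟶w ∷ w⟶^v) v-nf t⟶u with diamond t⟶u t⟶w
  ... | inj₁ refl = w⟶^v
  ... | inj₂ (x , u⟶x , w⟶x) with w⟶^v
  ...   | []        = ⊥-elim (v-nf (x , w⟶x))
  ...   | path@(_ ∷ _) = u⟶x ∷ step-shortens-path-to-normal path v-nf w⟶x

ext-cong : ∀ {ρ ρ' : ℕ → ℕ} → (∀ n → ρ n ≡ ρ' n) → ∀ n → ext ρ n ≡ ext ρ' n
ext-cong h zero    = refl
ext-cong h (suc n) = cong suc (h n)

rename-cong : ∀ {ρ ρ'} → (∀ n → ρ n ≡ ρ' n) → ∀ t → rename ρ t ≡ rename ρ' t
rename-cong h (var n)   = cong var (h n)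
rename-cong h (lam t)   = cong lam (rename-cong (ext-cong h) t)
rename-cong h (app t u) = cong₂ app (rename-cong h t) (rename-cong h u)
rename-cong h (bang t)  = cong bang (rename-cong h t)

exts-cong : ∀ {σ τ : ℕ → Term} → (∀ n → σ n ≡ τ n) → ∀ n → exts σ n ≡ exts τ n
exts-cong h zero    = refl
exts-cong h (suc n) = cong (rename suc) (h n)

subst-cong : ∀ {σ τ} → (∀ n → σ n ≡ τ n) → ∀ t → subst σ t ≡ subst τ t
subst-cong h (var n)   = h n
subst-cong h (lam t)   = cong lam (subst-cong (exts-cong h) t)
subst-cong h (app t u) = cong₂ app (subst-cong h t) (subst-cong h u)
subst-cong h (bang t)  = cong bang (subst-cong h t)

rename-rename : ∀ ρ ρ' t → rename ρ (rename ρ' t) ≡ rename (λ n → ρ (ρ' n)) t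
rename-rename ρ ρ' (var n)   = refl
rename-rename ρ ρ' (lam t)   =
  cong lam (trans (rename-rename (ext ρ) (ext ρ') t) (rename-cong ext-∘ t))
  where ext-∘ : ∀ n → ext ρ (ext ρ' n) ≡ ext (λ n → ρ (ρ' n)) n
        ext-∘ zero    = refl
        ext-∘ (suc n) = refl
rename-rename ρ ρ' (app t u) = cong₂ app (rename-rename ρ ρ' t) (rename-rename ρ ρ' u)
rename-rename ρ ρ' (bang t)  = cong bang (rename-rename ρ ρ' t)

subst-rename : ∀ σ ρ t → subst σ (rename ρ t) ≡ subst (λ n → σ (ρ n)) t
subst-rename σ ρ (var n)   = refl
subst-rename σ ρ (lam t)   =
  cong lam (trans (subst-rename (exts σ) (ext ρ) t) (subst-cong exts-ext t))
  where exts-ext : ∀ n → exts σ (ext ρ n) ≡ exts (λ n → σ (ρ n)) n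
        exts-ext zero    = refl
        exts-ext (suc n) = refl
subst-rename σ ρ (app t u) = cong₂ app (subst-rename σ ρ t) (subst-rename σ ρ u)
subst-rename σ ρ (bang t)  = cong bang (subst-rename σ ρ t)

rename-subst : ∀ ρ σ t → rename ρ (subst σ t) ≡ subst (λ n → rename ρ (σ n)) t
rename-subst ρ σ (var n)   = refl
rename-subst ρ σ (lam t)   =
  cong lam (trans (rename-subst (ext ρ) (exts σ) t) (subst-cong rename-exts t))
  where rename-exts : ∀ n → rename (ext ρ) (exts σ n) ≡ exts (λ n → rename ρ (σ n)) n
        rename-exts zero    = refl
        rename-exts (suc n) =
          trans (rename-rename (ext ρ) suc (σ n)) (sym (rename-rename suc ρ (σ n)))
rename-subst ρ σ (app t u) = cong₂ app (rename-subst ρ σ t) (rename-subst ρ σ u)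
rename-subst ρ σ (bang t)  = cong bang (rename-subst ρ σ t)

subst-var : ∀ t → subst var t ≡ t
subst-var (var n)   = refl
subst-var (lam t)   = cong lam (trans (subst-cong exts-var t) (subst-var t))
  where exts-var : ∀ n → exts var n ≡ var n
        exts-var zero    = refl
        exts-var (suc n) = refl
subst-var (app t u) = cong₂ app (subst-var t) (subst-var u)
subst-var (bang t)  = cong bang (subst-var t)

subst-subst : ∀ σ τ t → subst σ (subst τ t) ≡ subst (λ n → subst σ (τ n)) t
subst-subst σ τ (var n)   = refl
subst-subst σ τ (lam t)   =
  cong lam (trans (subst-subst (exts σ) (exts τ) t) (subst-cong subst-exts t))
  where subst-exts : ∀ n → subst (exts σ) (exts τ n) ≡ exts (λ n → subst σ (τ n)) n
        subst-exts zero    = refl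
        subst-exts (suc n) =
          trans (subst-rename (exts σ) suc (τ n)) (sym (rename-subst suc σ (τ n)))
subst-subst σ τ (app t u) = cong₂ app (subst-subst σ τ t) (subst-subst σ τ u)
subst-subst σ τ (bang t)  = cong bang (subst-subst σ τ t)

rename-[/0] : ∀ ρ t s → rename ρ (t [ s /0]) ≡ rename (ext ρ) t [ rename ρ s /0]
rename-[/0] ρ t s = begin
  rename ρ (t [ s /0])
    ≡⟨ rename-subst ρ (single s) t ⟩
  subst (λ n → rename ρ (single s n)) t
    ≡⟨ subst-cong single-ext t ⟩
  subst (λ n → single (rename ρ s) (ext ρ n)) t
    ≡⟨ subst-rename (single (rename ρ s)) (ext ρ) t ⟨
  rename (ext ρ) t [ rename ρ s /0]
    ∎
  where
  open ≡-Reasoning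
  single-ext : ∀ n → rename ρ (single s n) ≡ single (rename ρ s) (ext ρ n)
  single-ext zero    = refl
  single-ext (suc n) = refl

subst-[/0] : ∀ σ t s → subst σ (t [ s /0]) ≡ subst (exts σ) t [ subst σ s /0]
subst-[/0] σ t s = begin
  subst σ (t [ s /0])
    ≡⟨ subst-subst σ (single s) t ⟩
  subst (λ n → subst σ (single s n)) t
    ≡⟨ subst-cong single-exts t ⟩
  subst (λ n → subst (single (subst σ s)) (exts σ n)) t
    ≡⟨ subst-subst (single (subst σ s)) (exts σ) t ⟨
  subst (exts σ) t [ subst σ s /0]
    ∎
  where
  open ≡-Reasoning
  single-exts : ∀ n → subst σ (single s n) ≡ subst (single (subst σ s)) (exts σ n)
  single-exts zero    = refl
  single-exts (suc n) =
    sym (trans (subst-rename (single (subst σ s)) suc (σ n)) (subst-var (σ n)))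

-- Leveled reduction

infix 4 _⟶[_]_ _⟶_ _⟶ₛ_ _⟶*_ _⟶ₛ*_ _⇒_ _⇒ᵢ_ _⇛ᵢ_ _⟶ℓℓ_

data _⟶[_]_ : Term → ℕ → Term → Set where
  β      : ∀ t s → app (lam t) (bang s) ⟶[ 0 ] t [ s /0]
  ξ-lam  : ∀ {t t' k} → t ⟶[ k ] t' → lam t ⟶[ k ] lam t'
  ξ-appˡ : ∀ {t t' u k} → t ⟶[ k ] t' → app t u ⟶[ k ] app t' u
  ξ-appʳ : ∀ {t u u' k} → u ⟶[ k ] u' → app t u ⟶[ k ] app t u'
  ξ-!    : ∀ {t t' k} → t ⟶[ k ] t' → bang t ⟶[ suc k ] bang t'

β-≡ : ∀ {t s u} → t [ s /0] ≡ u → app (lam t) (bang s) ⟶[ 0 ] u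
β-≡ refl = β _ _

rename-step : ∀ ρ {t t' k} → t ⟶[ k ] t' → rename ρ t ⟶[ k ] rename ρ t'
rename-step ρ (β t s)    = β-≡ (sym (rename-[/0] ρ t s))
rename-step ρ (ξ-lam r)  = ξ-lam (rename-step (ext ρ) r)
rename-step ρ (ξ-appˡ r) = ξ-appˡ (rename-step ρ r)
rename-step ρ (ξ-appʳ r) = ξ-appʳ (rename-step ρ r)
rename-step ρ (ξ-! r)    = ξ-! (rename-step ρ r)

subst-step : ∀ σ {t t' k} → t ⟶[ k ] t' → subst σ t ⟶[ k ] subst σ t'
subst-step σ (β t s)    = β-≡ (sym (subst-[/0] σ t s))
subst-step σ (ξ-lam r)  = ξ-lam (subst-step (exts σ) r)
subst-step σ (ξ-appˡ r) = ξ-appˡ (subst-step σ r)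
subst-step σ (ξ-appʳ r) = ξ-appʳ (subst-step σ r)
subst-step σ (ξ-! r)    = ξ-! (subst-step σ r)

_⟶_ : Term → Term → Set
t ⟶ u = ∃ λ k → t ⟶[ k ] u

_⟶ₛ_ : Term → Term → Set
t ⟶ₛ u = t ⟶[ 0 ] u

_⟶*_ : Term → Term → Set
_⟶*_ = Star _⟶_

_⟶ₛ*_ : Term → Term → Set
_⟶ₛ*_ = Star _⟶ₛ_

Normal : Term → Set
Normal = NormalFor _⟶_

SurfaceNormal : Term → Set
SurfaceNormal = NormalFor _⟶ₛ_

lam-⟶* : ∀ {t t'} → t ⟶* t' → lam t ⟶* lam t'
lam-⟶* = gmap lam (map₂ ξ-lam)

app-⟶* : ∀ {t t' u u'} → t ⟶* t' → u ⟶* u' → app t u ⟶* app t' u'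
app-⟶* {t' = t'} {u = u} r q =
  gmap (λ x → app x u) (map₂ ξ-appˡ) r ◅◅ gmap (app t') (map₂ ξ-appʳ) q

bang-⟶* : ∀ {t t'} → t ⟶* t' → bang t ⟶* bang t'
bang-⟶* = gmap bang λ (k , r) → suc k , ξ-! r

lam-⟶ₛ* : ∀ {t t'} → t ⟶ₛ* t' → lam t ⟶ₛ* lam t'
lam-⟶ₛ* = gmap lam ξ-lam

app-⟶ₛ* : ∀ {t t' u u'} → t ⟶ₛ* t' → u ⟶ₛ* u' → app t u ⟶ₛ* app t' u'
app-⟶ₛ* {t' = t'} {u = u} r q = gmap (λ x → app x u) ξ-appˡ r ◅◅ gmap (app t') ξ-appʳ q

subst-⟶ₛ* : ∀ σ {t t'} → t ⟶ₛ* t' → subst σ t ⟶ₛ* subst σ t'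
subst-⟶ₛ* σ = gmap (subst σ) (subst-step σ)

⟶ₛ-diamond : ∀ {t u v} → t ⟶ₛ u → t ⟶ₛ v → u ≡ v ⊎ ∃ λ w → u ⟶ₛ w × v ⟶ₛ w
⟶ₛ-diamond (β t s)            (β .t .s)          = inj₁ refl
⟶ₛ-diamond (β t s)            (ξ-appˡ (ξ-lam r)) = inj₂ (_ , subst-step (single s) r , β _ _)
⟶ₛ-diamond (ξ-appˡ (ξ-lam r)) (β t s)            = inj₂ (_ , β _ _ , subst-step (single s) r)
⟶ₛ-diamond (ξ-lam r)  (ξ-lam q) with ⟶ₛ-diamond r q
... | inj₁ refl          = inj₁ refl
... | inj₂ (w , r' , q') = inj₂ (lam w , ξ-lam r' , ξ-lam q')
⟶ₛ-diamond (ξ-appˡ r) (ξ-appˡ q) with ⟶ₛ-diamond r q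
... | inj₁ refl          = inj₁ refl
... | inj₂ (w , r' , q') = inj₂ (app w _ , ξ-appˡ r' , ξ-appˡ q')
⟶ₛ-diamond (ξ-appˡ r) (ξ-appʳ q) = inj₂ (_ , ξ-appʳ q , ξ-appˡ r)
⟶ₛ-diamond (ξ-appʳ r) (ξ-appˡ q) = inj₂ (_ , ξ-appˡ q , ξ-appʳ r)
⟶ₛ-diamond (ξ-appʳ r) (ξ-appʳ q) with ⟶ₛ-diamond r q
... | inj₁ refl          = inj₁ refl
... | inj₂ (w , r' , q') = inj₂ (app _ w , ξ-appʳ r' , ξ-appʳ q')

-- A step at positive level happens inside a !-box, so it cannot create a surface redex.
deep-step-reflects-⟶ₛ : ∀ {t u v k} → t ⟶[ suc k ] u → u ⟶ₛ v → ∃ (t ⟶ₛ_)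
deep-step-reflects-⟶ₛ (ξ-appˡ (ξ-lam r)) (β _ _)    = _ , β _ _
deep-step-reflects-⟶ₛ (ξ-appʳ (ξ-! r))   (β _ _)    = _ , β _ _
deep-step-reflects-⟶ₛ (ξ-lam r)          (ξ-lam q)  = map lam ξ-lam (deep-step-reflects-⟶ₛ r q)
deep-step-reflects-⟶ₛ (ξ-appˡ r)         (ξ-appˡ q) =
  map (λ x → app x _) ξ-appˡ (deep-step-reflects-⟶ₛ r q)
deep-step-reflects-⟶ₛ (ξ-appʳ r)         (ξ-appˡ q) = _ , ξ-appˡ q
deep-step-reflects-⟶ₛ (ξ-appˡ r)         (ξ-appʳ q) = _ , ξ-appʳ q
deep-step-reflects-⟶ₛ (ξ-appʳ r)         (ξ-appʳ q) = map (app _) ξ-appʳ (deep-step-reflects-⟶ₛ r q)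

-- Parallel reduction and factorization

data _⇒_ : Term → Term → Set where
  pvar  : ∀ n → var n ⇒ var n
  plam  : ∀ {t t'} → t ⇒ t' → lam t ⇒ lam t'
  papp  : ∀ {t t' u u'} → t ⇒ t' → u ⇒ u' → app t u ⇒ app t' u'
  pbang : ∀ {t t'} → t ⇒ t' → bang t ⇒ bang t'
  pβ    : ∀ {t t' s s'} → t ⇒ t' → s ⇒ s' → app (lam t) (bang s) ⇒ t' [ s' /0]

pβ-≡ : ∀ {t t' s s' u} → t ⇒ t' → s ⇒ s' → t' [ s' /0] ≡ u → app (lam t) (bang s) ⇒ u
pβ-≡ p q refl = pβ p q

⇒-refl : ∀ {t} → t ⇒ t
⇒-refl {var n}   = pvar n
⇒-refl {lam t}   = plam ⇒-refl
⇒-refl {app t u} = papp ⇒-refl ⇒-refl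
⇒-refl {bang t}  = pbang ⇒-refl

rename-⇒ : ∀ ρ {t t'} → t ⇒ t' → rename ρ t ⇒ rename ρ t'
rename-⇒ ρ (pvar n)   = pvar (ρ n)
rename-⇒ ρ (plam p)   = plam (rename-⇒ (ext ρ) p)
rename-⇒ ρ (papp p q) = papp (rename-⇒ ρ p) (rename-⇒ ρ q)
rename-⇒ ρ (pbang p)  = pbang (rename-⇒ ρ p)
rename-⇒ ρ (pβ {t' = t'} {s' = s'} p q) =
  pβ-≡ (rename-⇒ (ext ρ) p) (rename-⇒ ρ q) (sym (rename-[/0] ρ t' s'))

exts-⇒ : ∀ {σ τ} → (∀ n → σ n ⇒ τ n) → ∀ n → exts σ n ⇒ exts τ n
exts-⇒ h zero    = pvar 0
exts-⇒ h (suc n) = rename-⇒ suc (h n)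

subst-⇒ : ∀ {t t' σ τ} → t ⇒ t' → (∀ n → σ n ⇒ τ n) → subst σ t ⇒ subst τ t'
subst-⇒ (pvar n)   h = h n
subst-⇒ (plam p)   h = plam (subst-⇒ p (exts-⇒ h))
subst-⇒ (papp p q) h = papp (subst-⇒ p h) (subst-⇒ q h)
subst-⇒ (pbang p)  h = pbang (subst-⇒ p h)
subst-⇒ {τ = τ} (pβ {t' = t'} {s' = s'} p q) h =
  pβ-≡ (subst-⇒ p (exts-⇒ h)) (subst-⇒ q h) (sym (subst-[/0] τ t' s'))

single-⇒ : ∀ {s s'} → s ⇒ s' → ∀ n → single s n ⇒ single s' n
single-⇒ q zero    = q
single-⇒ q (suc n) = pvar n

step⇒⇒ : ∀ {t t' k} → t ⟶[ k ] t' → t ⇒ t'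
step⇒⇒ (β t s)    = pβ ⇒-refl ⇒-refl
step⇒⇒ (ξ-lam r)  = plam (step⇒⇒ r)
step⇒⇒ (ξ-appˡ r) = papp (step⇒⇒ r) ⇒-refl
step⇒⇒ (ξ-appʳ r) = papp ⇒-refl (step⇒⇒ r)
step⇒⇒ (ξ-! r)    = pbang (step⇒⇒ r)

⇒⇒⟶* : ∀ {t t'} → t ⇒ t' → t ⟶* t'
⇒⇒⟶* (pvar n)   = ε
⇒⇒⟶* (plam p)   = lam-⟶* (⇒⇒⟶* p)
⇒⇒⟶* (papp p q) = app-⟶* (⇒⇒⟶* p) (⇒⇒⟶* q)
⇒⇒⟶* (pbang p)  = bang-⟶* (⇒⇒⟶* p)
⇒⇒⟶* (pβ {t' = t'} {s' = s'} p q) =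
  app-⟶* (lam-⟶* (⇒⇒⟶* p)) (bang-⟶* (⇒⇒⟶* q)) ◅◅ (0 , β t' s') ◅ ε

data _⇒ᵢ_ : Term → Term → Set where
  ivar  : ∀ n → var n ⇒ᵢ var n
  ilam  : ∀ {t t'} → t ⇒ᵢ t' → lam t ⇒ᵢ lam t'
  iapp  : ∀ {t t' u u'} → t ⇒ᵢ t' → u ⇒ᵢ u' → app t u ⇒ᵢ app t' u'
  ibang : ∀ {t t'} → t ⇒ t' → bang t ⇒ᵢ bang t'

⇒ᵢ⇒⇒ : ∀ {t t'} → t ⇒ᵢ t' → t ⇒ t'
⇒ᵢ⇒⇒ (ivar n)   = pvar n
⇒ᵢ⇒⇒ (ilam p)   = plam (⇒ᵢ⇒⇒ p)
⇒ᵢ⇒⇒ (iapp p q) = papp (⇒ᵢ⇒⇒ p) (⇒ᵢ⇒⇒ q)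
⇒ᵢ⇒⇒ (ibang p)  = pbang p

rename-⇒ᵢ : ∀ ρ {t t'} → t ⇒ᵢ t' → rename ρ t ⇒ᵢ rename ρ t'
rename-⇒ᵢ ρ (ivar n)   = ivar (ρ n)
rename-⇒ᵢ ρ (ilam p)   = ilam (rename-⇒ᵢ (ext ρ) p)
rename-⇒ᵢ ρ (iapp p q) = iapp (rename-⇒ᵢ ρ p) (rename-⇒ᵢ ρ q)
rename-⇒ᵢ ρ (ibang p)  = ibang (rename-⇒ ρ p)

_⟶ₛ*⇒ᵢ_ : Term → Term → Set
t ⟶ₛ*⇒ᵢ u = ∃ λ m → t ⟶ₛ* m × m ⇒ᵢ u

rename-⟶ₛ*⇒ᵢ : ∀ ρ {t t'} → t ⟶ₛ*⇒ᵢ t' → rename ρ t ⟶ₛ*⇒ᵢ rename ρ t'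
rename-⟶ₛ*⇒ᵢ ρ (m , r , p) = rename ρ m , gmap (rename ρ) (rename-step ρ) r , rename-⇒ᵢ ρ p

lam-⟶ₛ*⇒ᵢ : ∀ {t t'} → t ⟶ₛ*⇒ᵢ t' → lam t ⟶ₛ*⇒ᵢ lam t'
lam-⟶ₛ*⇒ᵢ (m , r , p) = lam m , lam-⟶ₛ* r , ilam p

app-⟶ₛ*⇒ᵢ : ∀ {t t' u u'} → t ⟶ₛ*⇒ᵢ t' → u ⟶ₛ*⇒ᵢ u' → app t u ⟶ₛ*⇒ᵢ app t' u'
app-⟶ₛ*⇒ᵢ (m , r , p) (m' , r' , p') = app m m' , app-⟶ₛ* r r' , iapp p p'

subst-⟶ₛ*⇒ᵢ : ∀ {t t' σ τ} → t ⇒ᵢ t' →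
              (∀ n → σ n ⇒ τ n) → (∀ n → σ n ⟶ₛ*⇒ᵢ τ n) → subst σ t ⟶ₛ*⇒ᵢ subst τ t'
subst-⟶ₛ*⇒ᵢ (ivar n)   _ f = f n
subst-⟶ₛ*⇒ᵢ (ilam p)   h f = lam-⟶ₛ*⇒ᵢ (subst-⟶ₛ*⇒ᵢ p (exts-⇒ h) exts-f)
  where exts-f : ∀ n → exts _ n ⟶ₛ*⇒ᵢ exts _ n
        exts-f zero    = var 0 , ε , ivar 0
        exts-f (suc n) = rename-⟶ₛ*⇒ᵢ suc (f n)
subst-⟶ₛ*⇒ᵢ (iapp p q) h f = app-⟶ₛ*⇒ᵢ (subst-⟶ₛ*⇒ᵢ p h f) (subst-⟶ₛ*⇒ᵢ q h f)
subst-⟶ₛ*⇒ᵢ (ibang p)  h f = _ , ε , ibang (subst-⇒ p h)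

⇒-factorization : ∀ {t t'} → t ⇒ t' → t ⟶ₛ*⇒ᵢ t'
⇒-factorization (pvar n)   = var n , ε , ivar n
⇒-factorization (plam p)   = lam-⟶ₛ*⇒ᵢ (⇒-factorization p)
⇒-factorization (papp p q) = app-⟶ₛ*⇒ᵢ (⇒-factorization p) (⇒-factorization q)
⇒-factorization (pbang p)  = _ , ε , ibang p
⇒-factorization (pβ {t} {_} {s} {s'} p q) with ⇒-factorization p
... | m , t⟶ₛ*m , m⇒ᵢt' with subst-⟶ₛ*⇒ᵢ m⇒ᵢt' (single-⇒ q) single-f
  where single-f : ∀ n → single s n ⟶ₛ*⇒ᵢ single s' n
        single-f zero    = ⇒-factorization q
        single-f (suc n) = var n , ε , ivar n
... | m' , m⟶ₛ*m' , m'⇒ᵢ =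
  m' , β t s ◅ subst-⟶ₛ* (single s) t⟶ₛ*m ◅◅ m⟶ₛ*m' , m'⇒ᵢ

⇒ᵢ-⟶ₛ-swap : ∀ {t u v} → t ⇒ᵢ u → u ⟶ₛ v → ∃ λ w → t ⟶ₛ w × w ⇒ v
⇒ᵢ-⟶ₛ-swap (iapp (ilam p) (ibang q)) (β _ _) = _ , β _ _ , subst-⇒ (⇒ᵢ⇒⇒ p) (single-⇒ q)
⇒ᵢ-⟶ₛ-swap (ilam p)   (ξ-lam r)  with ⇒ᵢ-⟶ₛ-swap p r
... | w , r' , p' = lam w , ξ-lam r' , plam p'
⇒ᵢ-⟶ₛ-swap (iapp p q) (ξ-appˡ r) with ⇒ᵢ-⟶ₛ-swap p r
... | w , r' , p' = app w _ , ξ-appˡ r' , papp p' (⇒ᵢ⇒⇒ q)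
⇒ᵢ-⟶ₛ-swap (iapp p q) (ξ-appʳ r) with ⇒ᵢ-⟶ₛ-swap q r
... | w , r' , q' = app _ w , ξ-appʳ r' , papp (⇒ᵢ⇒⇒ p) q'

⇒ᵢ-⟶ₛ*-postpone : ∀ {t u v} → t ⇒ᵢ u → u ⟶ₛ* v → t ⟶ₛ*⇒ᵢ v
⇒ᵢ-⟶ₛ*-postpone p ε = _ , ε , p
⇒ᵢ-⟶ₛ*-postpone p (r ◅ rs) with ⇒ᵢ-⟶ₛ-swap p r
... | w , t⟶ₛw , w⇒ with ⇒-factorization w⇒
... | x , w⟶ₛ*x , x⇒ᵢ with ⇒ᵢ-⟶ₛ*-postpone x⇒ᵢ rs
... | y , x⟶ₛ*y , y⇒ᵢ = y , t⟶ₛw ◅ w⟶ₛ*x ◅◅ x⟶ₛ*y , y⇒ᵢ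

factorization : ∀ {t u} → t ⟶* u → ∃ λ w → t ⟶ₛ* w × Star _⇒ᵢ_ w u
factorization ε = _ , ε , ε
factorization ((_ , r) ◅ rs) with factorization rs
... | w , w⟶ₛ* , w⇒ᵢ* with ⇒-factorization (step⇒⇒ r)
... | x , t⟶ₛ*x , x⇒ᵢ with ⇒ᵢ-⟶ₛ*-postpone x⇒ᵢ w⟶ₛ*
... | y , x⟶ₛ*y , y⇒ᵢ = y , t⟶ₛ*x ◅◅ x⟶ₛ*y , y⇒ᵢ ◅ w⇒ᵢ*

⇒ᵢ-preserves-⟶ₛ : ∀ {t u v} → t ⇒ᵢ u → t ⟶ₛ v → ∃ (u ⟶ₛ_)
⇒ᵢ-preserves-⟶ₛ (iapp (ilam p) (ibang q)) (β _ _) = _ , β _ _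
⇒ᵢ-preserves-⟶ₛ (ilam p)   (ξ-lam r)  = map lam ξ-lam (⇒ᵢ-preserves-⟶ₛ p r)
⇒ᵢ-preserves-⟶ₛ (iapp p _) (ξ-appˡ r) = map (λ x → app x _) ξ-appˡ (⇒ᵢ-preserves-⟶ₛ p r)
⇒ᵢ-preserves-⟶ₛ (iapp _ q) (ξ-appʳ r) = map (app _) ξ-appʳ (⇒ᵢ-preserves-⟶ₛ q r)

⇒ᵢ*-reflects-surface-normal : ∀ {t u} → Star _⇒ᵢ_ t u → SurfaceNormal u → SurfaceNormal t
⇒ᵢ*-reflects-surface-normal ε        u-nf = u-nf
⇒ᵢ*-reflects-surface-normal (p ◅ ps) u-nf (_ , r) =
  ⇒ᵢ*-reflects-surface-normal ps u-nf (⇒ᵢ-preserves-⟶ₛ p r)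

-- A structural description of Star _⇒ᵢ_ (see ⇒ᵢ*⇒⇛ᵢ), suited to induction on the target.
data _⇛ᵢ_ : Term → Term → Set where
  mvar  : ∀ n → var n ⇛ᵢ var n
  mlam  : ∀ {t t'} → t ⇛ᵢ t' → lam t ⇛ᵢ lam t'
  mapp  : ∀ {t t' u u'} → t ⇛ᵢ t' → u ⇛ᵢ u' → app t u ⇛ᵢ app t' u'
  mbang : ∀ {t t'} → t ⟶* t' → bang t ⇛ᵢ bang t'

⇛ᵢ-refl : ∀ {t} → t ⇛ᵢ t
⇛ᵢ-refl {var n}   = mvar n
⇛ᵢ-refl {lam t}   = mlam ⇛ᵢ-refl
⇛ᵢ-refl {app t u} = mapp ⇛ᵢ-refl ⇛ᵢ-refl
⇛ᵢ-refl {bang t}  = mbang ε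

⇛ᵢ-⇒ᵢ-trans : ∀ {t u v} → t ⇛ᵢ u → u ⇒ᵢ v → t ⇛ᵢ v
⇛ᵢ-⇒ᵢ-trans (mvar n)   (ivar .n)  = mvar n
⇛ᵢ-⇒ᵢ-trans (mlam m)   (ilam p)   = mlam (⇛ᵢ-⇒ᵢ-trans m p)
⇛ᵢ-⇒ᵢ-trans (mapp m n) (iapp p q) = mapp (⇛ᵢ-⇒ᵢ-trans m p) (⇛ᵢ-⇒ᵢ-trans n q)
⇛ᵢ-⇒ᵢ-trans (mbang r)  (ibang p)  = mbang (r ◅◅ ⇒⇒⟶* p)

⇒ᵢ*⇒⇛ᵢ : ∀ {t u} → Star _⇒ᵢ_ t u → t ⇛ᵢ u
⇒ᵢ*⇒⇛ᵢ = foldl _⇛ᵢ_ ⇛ᵢ-⇒ᵢ-trans ⇛ᵢ-refl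

-- Least-level reduction

NoStepBelow : ℕ → Term → Set
NoStepBelow k t = ∀ {j u} → t ⟶[ j ] u → k ≤ j

_⟶ℓℓ_ : Term → Term → Set
t ⟶ℓℓ u = ∃ λ k → t ⟶[ k ] u × NoStepBelow k t

SN : Term → Set
SN = Acc (flip _⟶ℓℓ_)

sn-lam : ∀ {t} → SN t → SN (lam t)
sn-lam (acc rs) = acc λ where
  (k , ξ-lam r , below) → sn-lam (rs (k , r , λ r' → below (ξ-lam r')))

sn-bang : ∀ {t} → SN t → SN (bang t)
sn-bang (acc rs) = acc λ where
  (suc k , ξ-! r , below) → sn-bang (rs (k , r , λ r' → s≤s⁻¹ (below (ξ-! r'))))

sn-app : ∀ {t u} → SN t → SN u → SurfaceNormal (app t u) → SN (app t u)
sn-app (acc rt) (acc ru) nf = acc λ where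
  (zero , r , _) → ⊥-elim (nf (_ , r))
  (suc k , ξ-appˡ r , below) →
    sn-app (rt (suc k , r , λ r' → below (ξ-appˡ r'))) (acc ru)
           (λ (_ , q) → nf (deep-step-reflects-⟶ₛ (ξ-appˡ r) q))
  (suc k , ξ-appʳ r , below) →
    sn-app (acc rt) (ru (suc k , r , λ r' → below (ξ-appʳ r')))
           (λ (_ , q) → nf (deep-step-reflects-⟶ₛ (ξ-appʳ r) q))

open RandomDescent _⟶ₛ_ ⟶ₛ-diamond
  using (_⟶^[_]_; []; _∷_; Star⇒⟶^; step-shortens-path-to-normal)

-- A term with a surface step has no step of positive least level.
sn-surface-expansion : ∀ n {t u} → t ⟶^[ n ] u → SurfaceNormal u → SN u → SN t
sn-surface-expansion zero    []              _    u-sn = u-sn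
sn-surface-expansion (suc n) path@(t⟶ₛ ∷ _) u-nf u-sn = acc λ (k , r , below) →
  sn-surface-expansion n
    (step-shortens-path-to-normal path u-nf
      (transport (λ i → _ ⟶[ i ] _) (n≤0⇒n≡0 (below t⟶ₛ)) r))
    u-nf u-sn

⇛ᵢ-normal⇒sn : ∀ {t u} → t ⇛ᵢ u → Normal u → SurfaceNormal t → SN t
⟶*-normal⇒sn : ∀ {t u} → t ⟶* u → Normal u → SN t

⇛ᵢ-normal⇒sn (mvar n) _ _ = acc λ ()
⇛ᵢ-normal⇒sn (mlam m) nf snf = sn-lam (⇛ᵢ-normal⇒sn m
  (λ (_ , k , r) → nf (_ , k , ξ-lam r))
  (λ (_ , r) → snf (_ , ξ-lam r)))
⇛ᵢ-normal⇒sn (mapp m n) nf snf = sn-app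
  (⇛ᵢ-normal⇒sn m (λ (_ , k , r) → nf (_ , k , ξ-appˡ r)) (λ (_ , r) → snf (_ , ξ-appˡ r)))
  (⇛ᵢ-normal⇒sn n (λ (_ , k , r) → nf (_ , k , ξ-appʳ r)) (λ (_ , r) → snf (_ , ξ-appʳ r)))
  snf
⇛ᵢ-normal⇒sn (mbang r) nf _ = sn-bang (⟶*-normal⇒sn r
  (λ (_ , k , q) → nf (_ , suc k , ξ-! q)))

⟶*-normal⇒sn t⟶*u nf with factorization t⟶*u
... | t' , t⟶ₛ*t' , t'⇒ᵢ*u with Star⇒⟶^ t⟶ₛ*t'
... | n , path =
  sn-surface-expansion n path t'-nf (⇛ᵢ-normal⇒sn (⇒ᵢ*⇒⇛ᵢ t'⇒ᵢ*u) nf t'-nf)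
  where
  t'-nf : SurfaceNormal t'
  t'-nf = ⇒ᵢ*-reflects-surface-normal t'⇒ᵢ*u (λ (_ , r) → nf (_ , 0 , r))

redex? : ∀ t u → Dec (IsRedex (app t u))
redex? (lam t)   (bang s)  = yes (t , s , refl)
redex? (lam _)   (var _)   = no λ { (_ , _ , ()) }
redex? (lam _)   (lam _)   = no λ { (_ , _ , ()) }
redex? (lam _)   (app _ _) = no λ { (_ , _ , ()) }
redex? (var _)   _         = no λ { (_ , _ , ()) }
redex? (app _ _) _         = no λ { (_ , _ , ()) }
redex? (bang _)  _         = no λ { (_ , _ , ()) }

normal⇒no-step-below : ∀ k {t} → Normal t → NoStepBelow k t
normal⇒no-step-below k nf r = ⊥-elim (nf (_ , _ , r))

app-no-step-below : ∀ {k t u} → ¬ IsRedex (app t u) →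
                    NoStepBelow k t → NoStepBelow k u → NoStepBelow k (app t u)
app-no-step-below ¬redex _  _  (β t s)    = ⊥-elim (¬redex (t , s , refl))
app-no-step-below _      bt _  (ξ-appˡ r) = bt r
app-no-step-below _      _  bu (ξ-appʳ r) = bu r

normal-or-least-level-step : ∀ t → Normal t ⊎ ∃ (t ⟶ℓℓ_)
normal-or-least-level-step (var n) = inj₁ λ { (_ , _ , ()) }
normal-or-least-level-step (lam t) with normal-or-least-level-step t
... | inj₁ nf = inj₁ λ { (_ , k , ξ-lam r) → nf (_ , k , r) }
... | inj₂ (u , k , r , below) =
  inj₂ (lam u , k , ξ-lam r , λ { (ξ-lam r') → below r' })
normal-or-least-level-step (bang t) with normal-or-least-level-step t
... | inj₁ nf = inj₁ λ { (_ , _ , ξ-! r) → nf (_ , _ , r) }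
... | inj₂ (u , k , r , below) =
  inj₂ (bang u , suc k , ξ-! r , λ { (ξ-! r') → s≤s (below r') })
normal-or-least-level-step (app t u) with redex? t u
... | yes (t₀ , s , refl) = inj₂ (_ , 0 , β t₀ s , λ _ → z≤n)
... | no ¬redex with normal-or-least-level-step t | normal-or-least-level-step u
... | inj₁ nf-t | inj₁ nf-u = inj₁ λ where
  (_ , _ , β t₀ s)   → ¬redex (t₀ , s , refl)
  (_ , k , ξ-appˡ r) → nf-t (_ , k , r)
  (_ , k , ξ-appʳ r) → nf-u (_ , k , r)
... | inj₂ (t' , k , r , bt) | inj₁ nf-u =
  inj₂ (app t' u , k , ξ-appˡ r , app-no-step-below ¬redex bt (normal⇒no-step-below k nf-u))
... | inj₁ nf-t | inj₂ (u' , k , r , bu) =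
  inj₂ (app t u' , k , ξ-appʳ r , app-no-step-below ¬redex (normal⇒no-step-below k nf-t) bu)
... | inj₂ (t' , k , r , bt) | inj₂ (u' , k' , r' , bu) with ≤-total k k'
...   | inj₁ k≤k' = inj₂ (app t' u , k , ξ-appˡ r ,
                          app-no-step-below ¬redex bt (λ q → ≤-trans k≤k' (bu q)))
...   | inj₂ k'≤k = inj₂ (app t u' , k' , ξ-appʳ r' ,
                          app-no-step-below ¬redex (λ q → ≤-trans k'≤k (bt q)) bu)

-- Agreement with the context-based definitions of Defs

plug-step : ∀ C t s → plug C (app (lam t) (bang s)) ⟶[ lev C ] plug C (t [ s /0])
plug-step hole       t s = β t s
plug-step (lamC C)   t s = ξ-lam (plug-step C t s)
plug-step (appR u C) t s = ξ-appʳ (plug-step C t s)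
plug-step (appL C u) t s = ξ-appˡ (plug-step C t s)
plug-step (bangC C)  t s = ξ-! (plug-step C t s)

stepAt⇒⟶ : ∀ {C t u} → StepAt C t u → t ⟶[ lev C ] u
stepAt⇒⟶ {C} (step (!β t s)) = plug-step C t s

⟶⇒stepAt : ∀ {t u k} → t ⟶[ k ] u → ∃ λ C → StepAt C t u × lev C ≡ k
⟶⇒stepAt (β t s) = hole , step (!β t s) , refl
⟶⇒stepAt (ξ-lam r) with ⟶⇒stepAt r
... | C , step ρ , e = lamC C , step ρ , e
⟶⇒stepAt (ξ-appˡ {u = u} r) with ⟶⇒stepAt r
... | C , step ρ , e = appL C u , step ρ , e
⟶⇒stepAt (ξ-appʳ {t = t} r) with ⟶⇒stepAt r
... | C , step ρ , e = appR t C , step ρ , e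
⟶⇒stepAt (ξ-! r) with ⟶⇒stepAt r
... | C , step ρ , e = bangC C , step ρ , cong suc e

stepAt-redex : ∀ {C t u} → StepAt C t u → ∃ λ r → IsRedex r × t ≡ plug C r
stepAt-redex (step (!β t s)) = _ , (t , s , refl) , refl

→ll⇒⟶ℓℓ : ∀ {t u} → t →ll u → t ⟶ℓℓ u
→ll⇒⟶ℓℓ (C , st , least) = lev C , stepAt⇒⟶ st , below
  where
  below : NoStepBelow (lev C) _
  below r with ⟶⇒stepAt r
  ... | C' , st' , refl with stepAt-redex st'
  ... | R , isRedex , t≡C'[R] = least C' R isRedex t≡C'[R]

⟶ℓℓ⇒→ll : ∀ {t u} → t ⟶ℓℓ u → t →ll u
⟶ℓℓ⇒→ll (k , r , below) with ⟶⇒stepAt r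
... | C , st , refl = C , st , λ { C' _ (t , s , refl) refl → below (plug-step C' t s) }

!β-normal⇒Normal : ∀ {t} → !β-normal t → Normal t
!β-normal⇒Normal nf (u , _ , r) with ⟶⇒stepAt r
... | C , st , _ = nf (u , C , st)

→!β*⇒⟶* : ∀ {t u} → t →!β* u → t ⟶* u
→!β*⇒⟶* = gmap id λ (C , st) → lev C , stepAt⇒⟶ st

!β-normal⇒ll-normal : ∀ {t} → !β-normal t → ll-normal t
!β-normal⇒ll-normal nf (u , C , st , _) = nf (u , C , st)

ll-normal⇒!β-normal : ∀ {t} → ll-normal t → !β-normal t
ll-normal⇒!β-normal {t} ll-nf (u , C , st) with normal-or-least-level-step t
... | inj₁ nf        = nf (u , lev C , stepAt⇒⟶ st)
... | inj₂ (u' , ll) = ll-nf (u' , ⟶ℓℓ⇒→ll ll)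

theorem3 : (∀ (T : Term) → !β-normal T ⇔ ll-normal T)
    × (∀ (T U : Term) → T →!β* U → !β-normal U →
         (∀ (f : ℕ → Term) → ¬ InfiniteLLSeq T f)
         × (∀ (n : ℕ) (f : ℕ → Term) → MaximalFiniteLLSeq T n f → !β-normal (f n)))
theorem3 = (λ T → mk⇔ !β-normal⇒ll-normal ll-normal⇒!β-normal) , normalizing
  where
  normalizing : ∀ T U → T →!β* U → !β-normal U →
                (∀ f → ¬ InfiniteLLSeq T f) ×
                (∀ n f → MaximalFiniteLLSeq T n f → !β-normal (f n))
  normalizing T U T→*U U-nf =
    (λ f (f0≡T , steps) →
       Acc⇒¬descending f 0 (transport SN (sym f0≡T) T-sn) (λ i → →ll⇒⟶ℓℓ (steps i))) ,
    (λ n f (_ , _ , fn-ll-nf) → ll-normal⇒!β-normal fn-ll-nf)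
    where
    T-sn : SN T
    T-sn = ⟶*-normal⇒sn (→!β*⇒⟶* T→*U) (!β-normal⇒Normal U-nf)
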